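{- Let $\mathbf{A}\in\mathbb{RL}^B$. Then $\mathbf{A}$ is subdirectly irreducible if and only if the set of Boolean elements of $\mathbf{A}$ is $\{0,1\}$.
   Context: A residuated lattice is an algebra $(A;\wedge,\vee,\cdot,\to,0,1)$ with $(A;\wedge,\vee,0,1)$ a bounded lattice ($0$ least, $1$ greatest), $(A;\cdot,1)$ a commutative monoid, and $a\cdot b\le c$ iff $a\le b\to c$; $\neg a=a\to0$. An element $a$ is Boolean iff $a\vee\neg a=1$. $\mathbb{RL}^B$ is the class of residuated lattices expanded with a unary operation $B$ such that $Ba\le a$, $Ba\vee\neg Ba=1$, and $b\le Ba$ whenever $b\le a$ and $b\vee\neg b=1$. Subdirect irreducibility refers to $\mathbf{A}$ as an algebra in the signature $(\wedge,\vee,\cdot,\to,B,0,1)$. -}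

module Defs where

open import Level using (0ℓ)
open import Data.Product using (Σ; _×_; ∃; ∃-syntax; _,_)
open import Data.Sum using (_⊎_)
open import Relation.Nullary using (¬_)
open import Relation.Binary.PropositionalEquality using (_≡_; _≢_)
open import Relation.Binary.Structures using (IsEquivalence)
open import Algebra.Lattice.Structures using (IsLattice)
open import Algebra.Structures using (IsCommutativeMonoid)

record RLB : Set₁ where
  infixr 6 _∨_
  infixr 7 _∧_
  infixl 8 _·_
  infixr 5 _⇒_
  infix 4 _≤_
  field
    Carrier : Set
    _∧_ _∨_ _·_ _⇒_ : Carrier → Carrier → Carrier
    B : Carrier → Carrier
    𝟘 𝟙 : Carrier

  _≤_ : Carrier → Carrier → Set
  a ≤ b = a ∧ b ≡ a

  ¬' : Carrier → Carrier
  ¬' a = a ⇒ 𝟘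

  IsBoolean : Carrier → Set
  IsBoolean a = a ∨ ¬' a ≡ 𝟙

  field
    isLattice : IsLattice _≡_ _∨_ _∧_
    𝟘-least : ∀ a → 𝟘 ≤ a
    𝟙-greatest : ∀ a → a ≤ 𝟙
    isCommutativeMonoid : IsCommutativeMonoid _≡_ _·_ 𝟙
    residuation₁ : ∀ a b c → a · b ≤ c → a ≤ b ⇒ c
    residuation₂ : ∀ a b c → a ≤ b ⇒ c → a · b ≤ c
    B-below : ∀ a → B a ≤ a
    B-boolean : ∀ a → IsBoolean (B a)
    B-greatest : ∀ a b → b ≤ a → IsBoolean b → b ≤ B a

module _ (A : RLB) where
  open RLB A

  record Congruence : Set₁ where
    field
      rel : Carrier → Carrier → Set
      isEquivalence : IsEquivalence rel
      ∧-cong : ∀ {a a' b b'} → rel a a' → rel b b' → rel (a ∧ b) (a' ∧ b')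
      ∨-cong : ∀ {a a' b b'} → rel a a' → rel b b' → rel (a ∨ b) (a' ∨ b')
      ·-cong : ∀ {a a' b b'} → rel a a' → rel b b' → rel (a · b) (a' · b')
      ⇒-cong : ∀ {a a' b b'} → rel a a' → rel b b' → rel (a ⇒ b) (a' ⇒ b')
      B-cong : ∀ {a a'} → rel a a' → rel (B a) (B a')

  open Congruence

  NonIdentity : Congruence → Set
  NonIdentity θ = ∃[ a ] ∃[ b ] (rel θ a b × a ≢ b)

  _⊆_ : Congruence → Congruence → Set
  θ ⊆ ψ = ∀ {a b} → rel θ a b → rel ψ a b

  -- A is subdirectly irreducible: Con A has a monolith, i.e. a
  -- non-identity congruence contained in every non-identity congruence.
  SubdirectlyIrreducible : Set₁
  SubdirectlyIrreducible =
    Σ Congruence λ μ → NonIdentity μ × (∀ θ → NonIdentity θ → μ ⊆ θ)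

  BooleanElementsAre01 : Set
  BooleanElementsAre01 =
    (𝟘 ≢ 𝟙) × IsBoolean 𝟘 × IsBoolean 𝟙 × (∀ a → IsBoolean a → a ≡ 𝟘 ⊎ a ≡ 𝟙)

-- For a Boolean b the map x ↦ x · b preserves ∧, ∨, · and B, and preserves ⇒ up to one more
-- factor b, so x · b ≡ y · b is a congruence θ_b; since x = x · b ∨ x · ¬b, the congruences θ_b
-- and θ_¬b meet in the identity.  A Boolean a ∉ {0, 1} thus yields two non-identity congruences
-- with identity meet, which rules out a monolith.  Conversely, if 0 and 1 are the only Boolean
-- elements, a congruence θ identifying a ≠ b identifies the Boolean element B((a ⇒ b) ∧ (b ⇒ a))
-- with B 1 = 1; it cannot equal 1 as a ≠ b, so it is 0, whence 0 θ 1 and θ is total.  Hence the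
-- total congruence is the monolith.

module Submission where

open import Defs
open import Level using (0ℓ)
open import Function.Base using (_∘_)
open import Function.Bundles using (_⇔_; mk⇔)
open import Axiom.ExcludedMiddle using (ExcludedMiddle)
open import Data.Product using (_,_)
open import Data.Sum using (_⊎_; inj₁; inj₂)
open import Data.Unit using (⊤; tt)
open import Data.Empty using (⊥-elim)
open import Relation.Nullary using (yes; no)
open import Relation.Binary.PropositionalEquality
  using (_≡_; _≢_; refl; sym; trans; cong; cong₂; subst; subst₂; isEquivalence)
open import Relation.Binary.Bundles using (Poset)
open import Relation.Binary.Structures using (IsEquivalence)
open import Algebra.Bundles using (CommutativeSemigroup; CommutativeMonoid)
open import Algebra.Lattice.Bundles using (Lattice)
open import Algebra.Structures using (IsCommutativeBand)
import Algebra.Lattice.Properties.Lattice as LatticeProperties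
import Algebra.Properties.CommutativeSemigroup as CommutativeSemigroupProperties
import Relation.Binary.Lattice as OrderTheoretic
import Relation.Binary.Reasoning.PartialOrder as ≤-Reasoning
import Relation.Binary.Construct.On as On

module _ {c ℓ} (S : CommutativeSemigroup c ℓ) where
  open CommutativeSemigroup S
  open CommutativeSemigroupProperties S using (interchange)
  open import Relation.Binary.Reasoning.Setoid setoid

  ∙-distribʳ-∙-by-idempotent : ∀ {b} → b ∙ b ≈ b →
                               ∀ x y → (x ∙ y) ∙ b ≈ (x ∙ b) ∙ (y ∙ b)
  ∙-distribʳ-∙-by-idempotent {b} idem x y = begin
    (x ∙ y) ∙ b        ≈⟨ ∙-congˡ idem ⟨
    (x ∙ y) ∙ (b ∙ b)  ≈⟨ interchange x y b b ⟩
    (x ∙ b) ∙ (y ∙ b)  ∎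

module _ (A : RLB) where
  open RLB A

  private
    lattice : Lattice 0ℓ 0ℓ
    lattice = record { isLattice = isLattice }

    module L = OrderTheoretic.Lattice (LatticeProperties.∨-∧-orderTheoreticLattice lattice)

    ∧-idem : ∀ x → x ∧ x ≡ x
    ∧-idem = LatticeProperties.∧-idem lattice

    ∧-comm : ∀ x y → x ∧ y ≡ y ∧ x
    ∧-comm = Lattice.∧-comm lattice

  -- The library's natural order is x ≡ x ∧ y, the converse equation of RLB's x ∧ y ≡ x,
  -- hence the sym around every borrowed order fact.

  ≤-poset : Poset 0ℓ 0ℓ 0ℓ
  ≤-poset = record
    { _≈_ = _≡_
    ; _≤_ = _≤_
    ; isPartialOrder = record
      { isPreorder = record
        { isEquivalence = isEquivalence
        ; reflexive = λ { refl → sym L.refl }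
        ; trans = λ p q → sym (L.trans (sym p) (sym q))
        }
      ; antisym = λ p q → L.antisym (sym p) (sym q)
      }
    }

  open Poset ≤-poset public using ()
    renaming (refl to ≤-refl; reflexive to ≤-reflexive; trans to ≤-trans; antisym to ≤-antisym)

  x∧y≤x : ∀ x y → x ∧ y ≤ x
  x∧y≤x x y = sym (L.x∧y≤x x y)

  x∧y≤y : ∀ x y → x ∧ y ≤ y
  x∧y≤y x y = sym (L.x∧y≤y x y)

  ∧-greatest : ∀ {x y z} → x ≤ y → x ≤ z → x ≤ y ∧ z
  ∧-greatest p q = sym (L.∧-greatest (sym p) (sym q))

  x≤x∨y : ∀ x y → x ≤ x ∨ y
  x≤x∨y x y = sym (L.x≤x∨y x y)

  y≤x∨y : ∀ x y → y ≤ x ∨ y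
  y≤x∨y x y = sym (L.y≤x∨y x y)

  ∨-least : ∀ {x y z} → x ≤ z → y ≤ z → x ∨ y ≤ z
  ∨-least p q = sym (L.∨-least (sym p) (sym q))

  private
    ·-commutativeMonoid : CommutativeMonoid 0ℓ 0ℓ
    ·-commutativeMonoid = record { isCommutativeMonoid = isCommutativeMonoid }

    ∧-commutativeSemigroup : CommutativeSemigroup 0ℓ 0ℓ
    ∧-commutativeSemigroup = record
      { isCommutativeSemigroup =
          IsCommutativeBand.isCommutativeSemigroup (LatticeProperties.∧-isSemilattice lattice) }

  open CommutativeMonoid ·-commutativeMonoid public using ()
    renaming (assoc to ·-assoc; comm to ·-comm; identityˡ to ·-identityˡ; identityʳ to ·-identityʳ)

  open ≤-Reasoning ≤-poset

  modus-ponens : ∀ a z → (a ⇒ z) · a ≤ z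
  modus-ponens a z = residuation₂ _ _ _ ≤-refl

  ·-monoˡ-≤ : ∀ c {a b} → a ≤ b → a · c ≤ b · c
  ·-monoˡ-≤ c a≤b = residuation₂ _ _ _ (≤-trans a≤b (residuation₁ _ _ _ ≤-refl))

  ·-monoʳ-≤ : ∀ c {a b} → a ≤ b → c · a ≤ c · b
  ·-monoʳ-≤ c {a} {b} a≤b = subst₂ _≤_ (·-comm a c) (·-comm b c) (·-monoˡ-≤ c a≤b)

  x·y≤x : ∀ x y → x · y ≤ x
  x·y≤x x y = begin
    x · y  ≤⟨ ·-monoʳ-≤ x (𝟙-greatest y) ⟩
    x · 𝟙  ≡⟨ ·-identityʳ x ⟩
    x      ∎

  x·y≤y : ∀ x y → x · y ≤ y
  x·y≤y x y = subst (_≤ y) (·-comm y x) (x·y≤x y x)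

  ⇒-monoʳ-≤ : ∀ a {y z} → y ≤ z → a ⇒ y ≤ a ⇒ z
  ⇒-monoʳ-≤ a y≤z = residuation₁ _ _ _ (≤-trans (modus-ponens a _) y≤z)

  ⇒-antimonoˡ-≤ : ∀ {a b} z → a ≤ b → b ⇒ z ≤ a ⇒ z
  ⇒-antimonoˡ-≤ z a≤b = residuation₁ _ _ _ (≤-trans (·-monoʳ-≤ _ a≤b) (modus-ponens _ z))

  ·-distribʳ-∨ : ∀ a x y → (x ∨ y) · a ≡ x · a ∨ y · a
  ·-distribʳ-∨ a x y = ≤-antisym
    (residuation₂ _ _ _ (∨-least (residuation₁ _ _ _ (x≤x∨y _ _))
                                 (residuation₁ _ _ _ (y≤x∨y _ _))))
    (∨-least (·-monoˡ-≤ a (x≤x∨y x y)) (·-monoˡ-≤ a (y≤x∨y x y)))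

  ·-distribˡ-∨ : ∀ a x y → a · (x ∨ y) ≡ a · x ∨ a · y
  ·-distribˡ-∨ a x y = begin-equality
    a · (x ∨ y)    ≡⟨ ·-comm a (x ∨ y) ⟩
    (x ∨ y) · a    ≡⟨ ·-distribʳ-∨ a x y ⟩
    x · a ∨ y · a  ≡⟨ cong₂ _∨_ (·-comm x a) (·-comm y a) ⟩
    a · x ∨ a · y  ∎

  ⇒-curry : ∀ a x y → a ⇒ (x ⇒ y) ≡ a · x ⇒ y
  ⇒-curry a x y = ≤-antisym
    (residuation₁ _ _ _ (begin
      (a ⇒ (x ⇒ y)) · (a · x)  ≡⟨ ·-assoc _ a x ⟨
      (a ⇒ (x ⇒ y)) · a · x    ≤⟨ ·-monoˡ-≤ x (modus-ponens a _) ⟩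
      (x ⇒ y) · x              ≤⟨ modus-ponens x y ⟩
      y                        ∎))
    (residuation₁ _ _ _ (residuation₁ _ _ _ (begin
      (a · x ⇒ y) · a · x      ≡⟨ ·-assoc _ a x ⟩
      (a · x ⇒ y) · (a · x)    ≤⟨ modus-ponens _ y ⟩
      y                        ∎)))

  𝟙≤⇒⇒≤ : ∀ {a b} → 𝟙 ≤ a ⇒ b → a ≤ b
  𝟙≤⇒⇒≤ {a} {b} 𝟙≤a⇒b = subst (_≤ b) (·-identityˡ a) (residuation₂ _ _ _ 𝟙≤a⇒b)

  ⇒-refl : ∀ a → a ⇒ a ≡ 𝟙
  ⇒-refl a = ≤-antisym (𝟙-greatest _) (residuation₁ _ _ _ (≤-reflexive (·-identityˡ a)))

  𝟘-isBoolean : IsBoolean 𝟘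
  𝟘-isBoolean = ≤-antisym (𝟙-greatest _) (begin
    𝟙          ≡⟨ ⇒-refl 𝟘 ⟨
    ¬' 𝟘       ≤⟨ y≤x∨y 𝟘 _ ⟩
    𝟘 ∨ ¬' 𝟘   ∎)

  𝟙-isBoolean : IsBoolean 𝟙
  𝟙-isBoolean = ≤-antisym (𝟙-greatest _) (x≤x∨y 𝟙 _)

  x≤¬¬x : ∀ x → x ≤ ¬' (¬' x)
  x≤¬¬x x = residuation₁ _ _ _ (subst (_≤ 𝟘) (·-comm (¬' x) x) (modus-ponens x 𝟘))

  ¬-isBoolean : ∀ {a} → IsBoolean a → IsBoolean (¬' a)
  ¬-isBoolean {a} a∨¬a≡𝟙 = ≤-antisym (𝟙-greatest _) (begin
    𝟙                 ≡⟨ a∨¬a≡𝟙 ⟨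
    a ∨ ¬' a          ≤⟨ ∨-least (≤-trans (x≤¬¬x a) (y≤x∨y _ _)) (x≤x∨y _ _) ⟩
    ¬' a ∨ ¬' (¬' a)  ∎)

  ¬≡𝟙⇒≡𝟘 : ∀ {a} → ¬' a ≡ 𝟙 → a ≡ 𝟘
  ¬≡𝟙⇒≡𝟘 {a} ¬a≡𝟙 = ≤-antisym (begin
    a         ≡⟨ ·-identityˡ a ⟨
    𝟙 · a     ≡⟨ cong (_· a) ¬a≡𝟙 ⟨
    ¬' a · a  ≤⟨ modus-ponens a 𝟘 ⟩
    𝟘         ∎) (𝟘-least a)

  module _ {b} (b∨¬b≡𝟙 : IsBoolean b) where

    x≡x·b∨x·¬b : ∀ x → x ≡ x · b ∨ x · ¬' b
    x≡x·b∨x·¬b x = begin-equality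
      x                  ≡⟨ ·-identityʳ x ⟨
      x · 𝟙              ≡⟨ cong (x ·_) b∨¬b≡𝟙 ⟨
      x · (b ∨ ¬' b)     ≡⟨ ·-distribˡ-∨ x b (¬' b) ⟩
      x · b ∨ x · ¬' b   ∎

    ·-isBoolean : ∀ {c} → IsBoolean c → IsBoolean (c · b)
    ·-isBoolean {c} c∨¬c≡𝟙 = ≤-antisym (𝟙-greatest _) (begin
      𝟙                          ≡⟨ c∨¬c≡𝟙 ⟨
      c ∨ ¬' c                   ≡⟨ cong (_∨ ¬' c) (x≡x·b∨x·¬b c) ⟩
      (c · b ∨ c · ¬' b) ∨ ¬' c  ≤⟨ ∨-least (∨-least (x≤x∨y _ _) (≤-trans c·¬b≤¬cb (y≤x∨y _ _)))
                                            (≤-trans ¬c≤¬cb (y≤x∨y _ _)) ⟩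
      c · b ∨ ¬' (c · b)         ∎)
      where
      c·¬b≤¬cb : c · ¬' b ≤ ¬' (c · b)
      c·¬b≤¬cb = ≤-trans (x·y≤y c (¬' b)) (⇒-antimonoˡ-≤ 𝟘 (x·y≤y c b))

      ¬c≤¬cb : ¬' c ≤ ¬' (c · b)
      ¬c≤¬cb = ⇒-antimonoˡ-≤ 𝟘 (x·y≤x c b)

    ∧≡· : ∀ x → x ∧ b ≡ x · b
    ∧≡· x = ≤-antisym (begin
      x ∧ b                          ≡⟨ x≡x·b∨x·¬b (x ∧ b) ⟩
      (x ∧ b) · b ∨ (x ∧ b) · ¬' b   ≤⟨ ∨-least (·-monoˡ-≤ b (x∧y≤x x b)) (begin
        (x ∧ b) · ¬' b                 ≤⟨ ·-monoˡ-≤ (¬' b) (x∧y≤y x b) ⟩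
        b · ¬' b                       ≡⟨ ·-comm b (¬' b) ⟩
        ¬' b · b                       ≤⟨ modus-ponens b 𝟘 ⟩
        𝟘                              ≤⟨ 𝟘-least _ ⟩
        x · b                          ∎) ⟩
      x · b                          ∎)
      (∧-greatest (x·y≤x x b) (x·y≤y x b))

    ·-idem : b · b ≡ b
    ·-idem = trans (sym (∧≡· b)) (∧-idem b)

    ⇒·≡· : ∀ z → (b ⇒ z) · b ≡ z · b
    ⇒·≡· z = ≤-antisym
      (begin
        (b ⇒ z) · b   ≤⟨ ∧-greatest (modus-ponens b z) (x·y≤y _ b) ⟩
        z ∧ b         ≡⟨ ∧≡· z ⟩
        z · b         ∎)
      (·-monoˡ-≤ b (residuation₁ _ _ _ (x·y≤x z b)))

    ⇒-absorbs-· : ∀ z → b ⇒ z · b ≡ b ⇒ z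
    ⇒-absorbs-· z = ≤-antisym
      (⇒-monoʳ-≤ b (x·y≤x z b))
      (residuation₁ _ _ _ (≤-reflexive (⇒·≡· z)))

    ·-distribʳ-∧ : ∀ x y → (x ∧ y) · b ≡ x · b ∧ y · b
    ·-distribʳ-∧ x y = begin-equality
      (x ∧ y) · b        ≡⟨ ∧≡· (x ∧ y) ⟨
      (x ∧ y) ∧ b        ≡⟨ ∙-distribʳ-∙-by-idempotent ∧-commutativeSemigroup (∧-idem b) x y ⟩
      (x ∧ b) ∧ (y ∧ b)  ≡⟨ cong₂ _∧_ (∧≡· x) (∧≡· y) ⟩
      x · b ∧ y · b      ∎

    ·-distribʳ-· : ∀ x y → (x · y) · b ≡ (x · b) · (y · b)
    ·-distribʳ-· =
      ∙-distribʳ-∙-by-idempotent (CommutativeMonoid.commutativeSemigroup ·-commutativeMonoid) ·-idem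

    ·-distribʳ-⇒ : ∀ x y → (x ⇒ y) · b ≡ (x · b ⇒ y · b) · b
    ·-distribʳ-⇒ x y = begin-equality
      (x ⇒ y) · b            ≡⟨ ⇒·≡· (x ⇒ y) ⟨
      (b ⇒ (x ⇒ y)) · b      ≡⟨ cong (_· b) (begin-equality
        b ⇒ (x ⇒ y)            ≡⟨ ⇒-curry b x y ⟩
        b · x ⇒ y              ≡⟨ cong (_⇒ y) (·-comm b x) ⟩
        x · b ⇒ y              ≡⟨ ⇒-curry x b y ⟨
        x ⇒ (b ⇒ y)            ≡⟨ cong (x ⇒_) (⇒-absorbs-· y) ⟨
        x ⇒ (b ⇒ y · b)        ≡⟨ ⇒-curry x b (y · b) ⟩
        x · b ⇒ y · b          ∎) ⟩
      (x · b ⇒ y · b) · b    ∎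

    B-·-comm : ∀ x → B x · b ≡ B (x · b)
    B-·-comm x = ≤-antisym
      (B-greatest _ _ (·-monoˡ-≤ b (B-below x)) (·-isBoolean (B-boolean x)))
      (begin
        B (x · b)   ≤⟨ ∧-greatest
                         (B-greatest _ _ (≤-trans (B-below _) (x·y≤x x b)) (B-boolean _))
                         (≤-trans (B-below _) (x·y≤y x b)) ⟩
        B x ∧ b     ≡⟨ ∧≡· (B x) ⟩
        B x · b     ∎)

    ·-kernel : Congruence A
    ·-kernel = record
      { rel = λ x y → x · b ≡ y · b
      ; isEquivalence = On.isEquivalence (_· b) isEquivalence
      ; ∧-cong = respects _∧_ _∧_ ·-distribʳ-∧
      ; ∨-cong = respects _∨_ _∨_ (·-distribʳ-∨ b)
      ; ·-cong = respects _·_ _·_ ·-distribʳ-·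
      ; ⇒-cong = respects _⇒_ (λ u v → (u ⇒ v) · b) ·-distribʳ-⇒
      ; B-cong = λ {x} {x'} p → begin-equality
          B x · b     ≡⟨ B-·-comm x ⟩
          B (x · b)   ≡⟨ cong B p ⟩
          B (x' · b)  ≡⟨ B-·-comm x' ⟨
          B x' · b    ∎
      }
      where
      respects : ∀ (_∙_ g : Carrier → Carrier → Carrier) →
                 (∀ x y → (x ∙ y) · b ≡ g (x · b) (y · b)) →
                 ∀ {x x' y y'} → x · b ≡ x' · b → y · b ≡ y' · b →
                 (x ∙ y) · b ≡ (x' ∙ y') · b
      respects _∙_ g hom {x} {x'} {y} {y'} p q = begin-equality
        (x ∙ y) · b          ≡⟨ hom x y ⟩
        g (x · b) (y · b)    ≡⟨ cong₂ g p q ⟩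
        g (x' · b) (y' · b)  ≡⟨ hom x' y' ⟨
        (x' ∙ y') · b        ∎

    ·-kernel-nonIdentity : b ≢ 𝟙 → NonIdentity A ·-kernel
    ·-kernel-nonIdentity b≢𝟙 = b , 𝟙 , trans ·-idem (sym (·-identityˡ b)) , b≢𝟙

    ·-kernels-disjoint : ∀ {x y} → x · b ≡ y · b → x · ¬' b ≡ y · ¬' b → x ≡ y
    ·-kernels-disjoint {x} {y} xb≡yb x¬b≡y¬b = begin-equality
      x                  ≡⟨ x≡x·b∨x·¬b x ⟩
      x · b ∨ x · ¬' b   ≡⟨ cong₂ _∨_ xb≡yb x¬b≡y¬b ⟩
      y · b ∨ y · ¬' b   ≡⟨ x≡x·b∨x·¬b y ⟨
      y                  ∎

  𝟘≡𝟙⇒≡𝟘 : 𝟘 ≡ 𝟙 → ∀ x → x ≡ 𝟘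
  𝟘≡𝟙⇒≡𝟘 𝟘≡𝟙 x = ≤-antisym (subst (x ≤_) (sym 𝟘≡𝟙) (𝟙-greatest x)) (𝟘-least x)

  SubdirectlyIrreducible⇒BooleanElementsAre01 :
    ExcludedMiddle 0ℓ → SubdirectlyIrreducible A → BooleanElementsAre01 A
  SubdirectlyIrreducible⇒BooleanElementsAre01 em (μ , (p , q , p∼q , p≢q) , μ-least) =
    𝟘≢𝟙 , 𝟘-isBoolean , 𝟙-isBoolean , classify
    where
    𝟘≢𝟙 : 𝟘 ≢ 𝟙
    𝟘≢𝟙 𝟘≡𝟙 = p≢q (trans (𝟘≡𝟙⇒≡𝟘 𝟘≡𝟙 p) (sym (𝟘≡𝟙⇒≡𝟘 𝟘≡𝟙 q)))

    classify : ∀ a → IsBoolean a → a ≡ 𝟘 ⊎ a ≡ 𝟙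
    classify a a-isBoolean with em {a ≡ 𝟘} | em {a ≡ 𝟙}
    ... | yes a≡𝟘 | _       = inj₁ a≡𝟘
    ... | no _    | yes a≡𝟙 = inj₂ a≡𝟙
    ... | no a≢𝟘  | no a≢𝟙  = ⊥-elim (p≢q (·-kernels-disjoint a-isBoolean
      (μ-least (·-kernel a-isBoolean) (·-kernel-nonIdentity a-isBoolean a≢𝟙) p∼q)
      (μ-least (·-kernel ¬a-isBoolean)
               (·-kernel-nonIdentity ¬a-isBoolean (a≢𝟘 ∘ ¬≡𝟙⇒≡𝟘)) p∼q)))
      where
      ¬a-isBoolean : IsBoolean (¬' a)
      ¬a-isBoolean = ¬-isBoolean a-isBoolean

  _↔_ : Carrier → Carrier → Carrier
  a ↔ b = (a ⇒ b) ∧ (b ⇒ a)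

  ↔-refl : ∀ a → a ↔ a ≡ 𝟙
  ↔-refl a = trans (∧-idem (a ⇒ a)) (⇒-refl a)

  𝟙≤↔⇒≡ : ∀ {a b} → 𝟙 ≤ a ↔ b → a ≡ b
  𝟙≤↔⇒≡ 𝟙≤a↔b = ≤-antisym (𝟙≤⇒⇒≤ (≤-trans 𝟙≤a↔b (x∧y≤x _ _)))
                           (𝟙≤⇒⇒≤ (≤-trans 𝟙≤a↔b (x∧y≤y _ _)))

  B𝟙≡𝟙 : B 𝟙 ≡ 𝟙
  B𝟙≡𝟙 = ≤-antisym (𝟙-greatest _) (B-greatest 𝟙 𝟙 ≤-refl 𝟙-isBoolean)

  ∇ : Congruence A
  ∇ = record
    { rel = λ _ _ → ⊤
    ; isEquivalence = record { refl = tt ; sym = λ _ → tt ; trans = λ _ _ → tt }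
    ; ∧-cong = λ _ _ → tt
    ; ∨-cong = λ _ _ → tt
    ; ·-cong = λ _ _ → tt
    ; ⇒-cong = λ _ _ → tt
    ; B-cong = λ _ → tt
    }

  module _ (θ : Congruence A) where
    open Congruence θ using (∧-cong; ⇒-cong; B-cong) renaming (rel to _∼_)
    private module ∼ = IsEquivalence (Congruence.isEquivalence θ)

    ∼⇒B↔∼𝟙 : ∀ {a b} → a ∼ b → B (a ↔ b) ∼ 𝟙
    ∼⇒B↔∼𝟙 {a} {b} a∼b = subst (B (a ↔ b) ∼_) (trans (cong B (↔-refl b)) B𝟙≡𝟙)
      (B-cong (∧-cong (⇒-cong a∼b ∼.refl) (⇒-cong ∼.refl a∼b)))

    𝟘∼𝟙⇒∇⊆ : 𝟘 ∼ 𝟙 → _⊆_ A ∇ θ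
    𝟘∼𝟙⇒∇⊆ 𝟘∼𝟙 {x} {y} _ = ∼.trans (∼.sym (𝟘∼ x)) (𝟘∼ y)
      where
      𝟘∼ : ∀ x → 𝟘 ∼ x
      𝟘∼ x = subst₂ _∼_ (trans (∧-comm x 𝟘) (𝟘-least x)) (𝟙-greatest x) (∧-cong ∼.refl 𝟘∼𝟙)

  BooleanElementsAre01⇒SubdirectlyIrreducible : BooleanElementsAre01 A → SubdirectlyIrreducible A
  BooleanElementsAre01⇒SubdirectlyIrreducible (𝟘≢𝟙 , _ , _ , classify) =
    ∇ , (𝟘 , 𝟙 , tt , 𝟘≢𝟙) , ∇-least
    where
    ∇-least : ∀ θ → NonIdentity A θ → _⊆_ A ∇ θ
    ∇-least θ (a , b , a∼b , a≢b) with classify (B (a ↔ b)) (B-boolean (a ↔ b))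
    ... | inj₁ B↔≡𝟘 = 𝟘∼𝟙⇒∇⊆ θ (subst (λ c → Congruence.rel θ c 𝟙) B↔≡𝟘 (∼⇒B↔∼𝟙 θ a∼b))
    ... | inj₂ B↔≡𝟙 = ⊥-elim (a≢b (𝟙≤↔⇒≡ (subst (_≤ a ↔ b) B↔≡𝟙 (B-below (a ↔ b)))))

proposition13 : ExcludedMiddle 0ℓ → (A : RLB) →
    SubdirectlyIrreducible A ⇔ BooleanElementsAre01 A
proposition13 em A = mk⇔
  (SubdirectlyIrreducible⇒BooleanElementsAre01 A em)
  (BooleanElementsAre01⇒SubdirectlyIrreducible A)
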